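{- Let $j\ge1$ and $\gamma\ge2$ be integers with $j+\gamma\le n$, and let $g\in\mathbb{C}[x_1,\ldots,x_n]$ satisfy $\overline{\partial}_{j+1}(g)=\cdots=\overline{\partial}_{j+\gamma-1}(g)=g$ and $\partial_{j+1}(g)=\cdots=\partial_{j+\gamma-1}(g)=0$. Put $g'=\overline{\pi}_j(g)$, $j'=j+1$, $\gamma'=\gamma-1$. Then $\overline{\partial}_{j'+1}(g')=\cdots=\overline{\partial}_{j'+\gamma'-1}(g')=g'$ and $\partial_{j'+1}(g')=\cdots=\partial_{j'+\gamma'-1}(g')=0$.
   Context: For $k\in[n-1]$: $\partial_k(f)=\frac{f-s_kf}{x_k-x_{k+1}}$ where $s_kf$ is $f$ with $x_k,x_{k+1}$ swapped; $\overline{\partial}_k(f)=\partial_k((1-x_{k+1})f)$; $\overline{\pi}_k(f)=\partial_k(x_k(1-x_{k+1})f)$. The condition $j+\gamma\le n$ only ensures all operators involved are defined; when $\gamma'=1$ the conclusion is vacuous. -}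

module Defs where

open import Level using (_⊔_)
open import Algebra.Bundles using (CommutativeRing)
open import Data.Nat using (ℕ; zero; suc)
open import Data.Nat.Properties using () renaming (_≟_ to _≟ℕ_)
open import Data.Vec using (Vec; []; _∷_; replicate; zipWith)
open import Data.Vec.Properties using (≡-dec)
open import Data.List using (List; []; _∷_; _++_; map; concatMap)
open import Data.Product using (_×_; _,_)
open import Relation.Nullary using (yes; no)
open import Relation.Binary.PropositionalEquality using (_≡_)

-- Exponent vectors (monomials) in n variables x₁,…,xₙ (1-based indices)

Mon : ℕ → Set
Mon n = Vec ℕ n

-- exponent vector of the variable x_i  (i is 1-based; i = 0 or i > n gives 1)
unitMon : (n : ℕ) → ℕ → Mon n
unitMon zero    _             = []
unitMon (suc n) zero          = replicate (suc n) 0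
unitMon (suc n) (suc zero)    = 1 ∷ replicate n 0
unitMon (suc n) (suc (suc i)) = 0 ∷ unitMon n (suc i)

swapMon : {n : ℕ} → ℕ → Mon n → Mon n
swapMon (suc zero)    (a ∷ b ∷ v) = b ∷ a ∷ v
swapMon (suc (suc k)) (a ∷ v)     = a ∷ swapMon (suc k) v
swapMon _             v           = v

-- The polynomial ring R[x₁,…,xₙ] over a commutative ring R:
-- finite formal sums of terms c·x^e, compared coefficientwise.

module Poly {c ℓ} (R : CommutativeRing c ℓ) where
  open CommutativeRing R renaming (Carrier to A)

  Pol : ℕ → Set c
  Pol n = List (A × Mon n)

  coeff : {n : ℕ} → Pol n → Mon n → A
  coeff []             e = 0#
  coeff ((a , f) ∷ p) e with ≡-dec _≟ℕ_ f e
  ... | yes _ = a + coeff p e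
  ... | no  _ = coeff p e

  _≋_ : {n : ℕ} → Pol n → Pol n → Set ℓ
  p ≋ q = ∀ e → coeff p e ≈ coeff q e

  zeroP : {n : ℕ} → Pol n
  zeroP = []

  oneP : {n : ℕ} → Pol n
  oneP {n} = (1# , replicate n 0) ∷ []

  X : {n : ℕ} → ℕ → Pol n
  X {n} i = (1# , unitMon n i) ∷ []

  _+P_ : {n : ℕ} → Pol n → Pol n → Pol n
  p +P q = p ++ q

  negP : {n : ℕ} → Pol n → Pol n
  negP = map (λ { (a , e) → (- a , e) })

  _-P_ : {n : ℕ} → Pol n → Pol n → Pol n
  p -P q = p +P negP q

  _*P_ : {n : ℕ} → Pol n → Pol n → Pol n
  p *P q = concatMap (λ { (a , e) → map (λ { (b , f) → (a * b , zipWith Data.Nat._+_ e f) }) q }) p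

  swapP : {n : ℕ} → ℕ → Pol n → Pol n
  swapP k = map (λ { (a , e) → (a , swapMon k e) })

  -- ∂_k(f) = h  :⇔  h = (f - s_k f)/(x_k - x_{k+1}),
  -- i.e. (x_k - x_{k+1})·h = f - s_k f  (x_k - x_{k+1} is a non-zero-divisor,
  -- so h is uniquely determined up to ≋).
  IsDD : {n : ℕ} → ℕ → Pol n → Pol n → Set ℓ
  IsDD k f h = ((X k -P X (suc k)) *P h) ≋ (f -P swapP k f)

  IsDDbar : {n : ℕ} → ℕ → Pol n → Pol n → Set ℓ
  IsDDbar k f h = IsDD k ((oneP -P X (suc k)) *P f) h

  IsPibar : {n : ℕ} → ℕ → Pol n → Pol n → Set ℓ
  IsPibar k f h = IsDD k ((X k *P (oneP -P X (suc k))) *P f) h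

{-# OPTIONS --safe #-}

-- A polynomial f satisfies ∂ᵢ f = 0 exactly when it is symmetric in xᵢ, x_{i+1}.
-- For i ≥ j + 2 the transposition sᵢ commutes with sⱼ and fixes xⱼ and x_{j+1},
-- so it commutes with π̄ⱼ; as g is sᵢ-symmetric, so is g′ = π̄ⱼ g.  For an
-- sᵢ-symmetric h the Leibniz rule gives ∂̄ᵢ h = ∂ᵢ(1 − x_{i+1}) · h = h.
-- Divided differences are given as solutions h of (xₖ − x_{k+1}) h = f − sₖ f;
-- these are unique because xₖ − x_{k+1} is a non-zero-divisor.

module Submission where

open import Defs
open import Algebra.Bundles using (CommutativeRing)
open import Data.Nat using (ℕ; zero; suc; _∸_; _≤_; _<_; z≤n; s≤s; _≤?_)
import Data.Nat.Properties as ℕ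
open import Data.Product using (_×_; _,_; ∃; proj₁; proj₂)
open import Data.List using ([]; _∷_; _++_; map)
open import Data.List.Properties using (map-++)
open import Data.Vec using ([]; _∷_; replicate; zipWith)
open import Data.Vec.Properties
  using (≡-dec; ∷-injective; zipWith-identityˡ; zipWith-assoc; zipWith-comm)
open import Data.Empty using (⊥-elim)
open import Relation.Binary.Bundles using (Setoid)
open import Relation.Binary.PropositionalEquality as ≡ using (_≡_; refl; cong; cong₂)
open import Relation.Nullary using (Dec; yes; no; ¬_)

module Monomials where
  open import Data.Nat using (_+_)

  infixl 6 _⊞_
  _⊞_ : ∀ {n} → Mon n → Mon n → Mon n
  _⊞_ = zipWith _+_

  ⊞-identityˡ : ∀ {n} (f : Mon n) → replicate n 0 ⊞ f ≡ f
  ⊞-identityˡ = zipWith-identityˡ ℕ.+-identityˡ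

  ⊞-exchange : ∀ {n} (a b f : Mon n) → a ⊞ (b ⊞ f) ≡ b ⊞ (a ⊞ f)
  ⊞-exchange a b f = begin
    a ⊞ (b ⊞ f)  ≡⟨ zipWith-assoc ℕ.+-assoc a b f ⟨
    (a ⊞ b) ⊞ f  ≡⟨ cong (_⊞ f) (zipWith-comm ℕ.+-comm a b) ⟩
    (b ⊞ a) ⊞ f  ≡⟨ zipWith-assoc ℕ.+-assoc b a f ⟩
    b ⊞ (a ⊞ f)  ∎
    where open ≡.≡-Reasoning

  ⊞-cancelˡ : ∀ {n} (m : Mon n) {f f′ : Mon n} → m ⊞ f ≡ m ⊞ f′ → f ≡ f′
  ⊞-cancelˡ []      {[]}    {[]}      _  = refl
  ⊞-cancelˡ (x ∷ m) {y ∷ f} {y′ ∷ f′} eq =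
    cong₂ _∷_ (ℕ.+-cancelˡ-≡ x y y′ (proj₁ (∷-injective eq)))
              (⊞-cancelˡ m (proj₂ (∷-injective eq)))

  _∣ᵐ_ : ∀ {n} → Mon n → Mon n → Set
  m ∣ᵐ e = ∃ λ f → m ⊞ f ≡ e

  _∣ᵐ?_ : ∀ {n} (m e : Mon n) → Dec (m ∣ᵐ e)
  []      ∣ᵐ? []      = yes ([] , refl)
  (x ∷ m) ∣ᵐ? (y ∷ e) with x ≤? y | m ∣ᵐ? e
  ... | yes x≤y | yes (f , m⊞f≡e) = yes (y ∸ x ∷ f , cong₂ _∷_ (ℕ.m+[n∸m]≡n x≤y) m⊞f≡e)
  ... | yes _   | no m∤e = no λ { (_ ∷ f , eq) → m∤e (f , proj₂ (∷-injective eq)) }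
  ... | no x≰y  | _      =
    no λ { (z ∷ _ , eq) → x≰y (≡.subst (x ≤_) (proj₁ (∷-injective eq)) (ℕ.m≤m+n x z)) }

  -- The exponent of xᵢ (1-based, as for unitMon; 0 when i = 0 or i > n).
  exponent : ∀ {n} → ℕ → Mon n → ℕ
  exponent _             []      = 0
  exponent zero          (_ ∷ _) = 0
  exponent (suc zero)    (x ∷ _) = x
  exponent (suc (suc i)) (_ ∷ v) = exponent (suc i) v

  exponent-unitMon-⊞ : ∀ n i (f : Mon n) → 1 ≤ i → i ≤ n →
    exponent i (unitMon n i ⊞ f) ≡ suc (exponent i f)
  exponent-unitMon-⊞ (suc n) (suc zero)    (_ ∷ f) _ _        = refl
  exponent-unitMon-⊞ (suc n) (suc (suc i)) (_ ∷ f) _ (s≤s i≤n) =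
    exponent-unitMon-⊞ n (suc i) f (s≤s z≤n) i≤n

  exponent-suc-unitMon-⊞ : ∀ n k (f : Mon n) →
    exponent (suc k) (unitMon n k ⊞ f) ≡ exponent (suc k) f
  exponent-suc-unitMon-⊞ zero    k             []      = refl
  exponent-suc-unitMon-⊞ (suc n) zero          (_ ∷ f) = refl
  exponent-suc-unitMon-⊞ (suc n) (suc zero)    (_ ∷ f) = cong (exponent 1) (⊞-identityˡ f)
  exponent-suc-unitMon-⊞ (suc n) (suc (suc k)) (_ ∷ f) = exponent-suc-unitMon-⊞ n (suc k) f

  unitMon-suc-∤ : ∀ n k (f : Mon n) → suc k ≤ n → exponent (suc k) f ≡ 0 →
    ¬ unitMon n (suc k) ∣ᵐ (unitMon n k ⊞ f)
  unitMon-suc-∤ n k f k<n f₍ₖ₊₁₎≡0 (g , xₖ₊₁⊞g≡xₖ⊞f) = ℕ.1+n≢0 (begin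
    suc (exponent (suc k) g)                  ≡⟨ exponent-unitMon-⊞ n (suc k) g (s≤s z≤n) k<n ⟨
    exponent (suc k) (unitMon n (suc k) ⊞ g)  ≡⟨ cong (exponent (suc k)) xₖ₊₁⊞g≡xₖ⊞f ⟩
    exponent (suc k) (unitMon n k ⊞ f)        ≡⟨ exponent-suc-unitMon-⊞ n k f ⟩
    exponent (suc k) f                        ≡⟨ f₍ₖ₊₁₎≡0 ⟩
    0                                         ∎)
    where open ≡.≡-Reasoning

  exponent≡suc⇒unitMon-∣ᵐ : ∀ {n} i (f : Mon n) t → exponent i f ≡ suc t →
    ∃ λ f″ → unitMon n i ⊞ f″ ≡ f × exponent i f″ ≡ t
  exponent≡suc⇒unitMon-∣ᵐ (suc zero)    (x ∷ f) t eq =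
    t ∷ f , cong₂ _∷_ (≡.sym eq) (⊞-identityˡ f) , refl
  exponent≡suc⇒unitMon-∣ᵐ (suc (suc i)) (x ∷ f) t eq
    with f″ , i∣f , exp≡t ← exponent≡suc⇒unitMon-∣ᵐ (suc i) f t eq =
    x ∷ f″ , cong (x ∷_) i∣f , exp≡t

  swapMon-⊞ : ∀ {n} k (a b : Mon n) → swapMon k (a ⊞ b) ≡ swapMon k a ⊞ swapMon k b
  swapMon-⊞ zero          a                 b                 = refl
  swapMon-⊞ (suc zero)    []                []                = refl
  swapMon-⊞ (suc zero)    (_ ∷ [])          (_ ∷ [])          = refl
  swapMon-⊞ (suc zero)    (_ ∷ _ ∷ _)       (_ ∷ _ ∷ _)       = refl
  swapMon-⊞ (suc (suc k)) []                []                = refl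
  swapMon-⊞ (suc (suc k)) (x ∷ a)           (y ∷ b)           = cong (x + y ∷_) (swapMon-⊞ (suc k) a b)

  swapMon-involutive : ∀ {n} k (e : Mon n) → swapMon k (swapMon k e) ≡ e
  swapMon-involutive zero          e           = refl
  swapMon-involutive (suc zero)    []          = refl
  swapMon-involutive (suc zero)    (_ ∷ [])    = refl
  swapMon-involutive (suc zero)    (_ ∷ _ ∷ _) = refl
  swapMon-involutive (suc (suc k)) []          = refl
  swapMon-involutive (suc (suc k)) (x ∷ e)     = cong (x ∷_) (swapMon-involutive (suc k) e)

  swapMon-replicate : ∀ n k → swapMon k (replicate n 0) ≡ replicate n 0
  swapMon-replicate n             zero          = refl
  swapMon-replicate zero          (suc zero)    = refl
  swapMon-replicate (suc zero)    (suc zero)    = refl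
  swapMon-replicate (suc (suc n)) (suc zero)    = refl
  swapMon-replicate zero          (suc (suc k)) = refl
  swapMon-replicate (suc n)       (suc (suc k)) = cong (0 ∷_) (swapMon-replicate n (suc k))

  swapMon-unitMon-suc : ∀ n i → 1 ≤ i → suc i ≤ n → swapMon i (unitMon n (suc i)) ≡ unitMon n i
  swapMon-unitMon-suc (suc zero)    (suc zero)    _ (s≤s ())
  swapMon-unitMon-suc (suc (suc n)) (suc zero)    _ _          = refl
  swapMon-unitMon-suc (suc n)       (suc (suc i)) _ (s≤s i<n)  =
    cong (0 ∷_) (swapMon-unitMon-suc n (suc i) (s≤s z≤n) i<n)

  swapMon-unitMon-< : ∀ n m i → m < i → swapMon i (unitMon n m) ≡ unitMon n m
  swapMon-unitMon-< zero    m             zero          _ = refl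
  swapMon-unitMon-< zero    m             (suc zero)    _ = refl
  swapMon-unitMon-< zero    m             (suc (suc i)) _ = refl
  swapMon-unitMon-< (suc n) zero          i             _ = swapMon-replicate (suc n) i
  swapMon-unitMon-< (suc n) (suc zero)    (suc (suc i)) _ = cong (1 ∷_) (swapMon-replicate n (suc i))
  swapMon-unitMon-< (suc n) (suc (suc m)) (suc (suc i)) (s≤s (s≤s m<i)) =
    cong (0 ∷_) (swapMon-unitMon-< n (suc m) (suc i) (s≤s m<i))
  swapMon-unitMon-< (suc n) (suc zero)    (suc zero)    (s≤s ())

  swapMon-comm : ∀ {n} k i (e : Mon n) → suc k < i →
    swapMon i (swapMon k e) ≡ swapMon k (swapMon i e)
  swapMon-comm zero          i                   e           _ = refl
  swapMon-comm (suc zero)    (suc (suc (suc i))) []          _ = refl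
  swapMon-comm (suc zero)    (suc (suc (suc i))) (_ ∷ [])    _ = refl
  swapMon-comm (suc zero)    (suc (suc (suc i))) (_ ∷ _ ∷ _) _ = refl
  swapMon-comm (suc (suc k)) (suc (suc i))       []          _ = refl
  swapMon-comm (suc (suc k)) (suc (suc i))       (x ∷ e)     (s≤s (s≤s k<i)) =
    cong (x ∷_) (swapMon-comm (suc k) (suc i) e (s≤s k<i))
  swapMon-comm (suc zero)    (suc zero)          e           (s≤s ())
  swapMon-comm (suc zero)    (suc (suc zero))    e           (s≤s (s≤s ()))
  swapMon-comm (suc (suc k)) (suc zero)          e           (s≤s ())

open Monomials

module Properties {c ℓ} (R : CommutativeRing c ℓ) where
  open Poly R
  open CommutativeRing R renaming (Carrier to A; refl to ≈-refl)
  open import Algebra.Properties.Ring ring using (-1*x≈-x)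
  open import Algebra.Properties.AbelianGroup +-abelianGroup
    using (ε⁻¹≈ε; ⁻¹-∙-comm; ⁻¹-anti-homo‿-; x∙y⁻¹≈ε⇒x≈y; x≈y⇒x∙y⁻¹≈ε;
           //-rightDividesˡ; \\-leftDividesʳ)
  import Relation.Binary.Reasoning.Setoid as SetoidReasoning

  ≋-setoid : ℕ → Setoid c ℓ
  ≋-setoid n = record
    { Carrier       = Pol n
    ; _≈_           = _≋_
    ; isEquivalence = record
      { refl  = λ _ → ≈-refl
      ; sym   = λ p≋q e → sym (p≋q e)
      ; trans = λ p≋q q≋r e → trans (p≋q e) (q≋r e)
      }
    }

  term*P : ∀ {n} → A → Mon n → Pol n → Pol n
  term*P a m = map λ { (b , f) → (a * b , m ⊞ f) }

  -- x^m − x^m′; both X k -P X (suc k) and oneP -P X (suc k) are of this form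
  binomial : ∀ {n} → Mon n → Mon n → Pol n
  binomial m m′ = (1# , m) ∷ (- 1# , m′) ∷ []

  -- Coefficients

  coeff-++ : ∀ {n} (p q : Pol n) e → coeff (p ++ q) e ≈ coeff p e + coeff q e
  coeff-++ []            q e = sym (+-identityˡ _)
  coeff-++ ((a , f) ∷ p) q e with ≡-dec ℕ._≟_ f e
  ... | yes _ = trans (+-congˡ (coeff-++ p q e)) (sym (+-assoc _ _ _))
  ... | no  _ = coeff-++ p q e

  coeff-negP : ∀ {n} (p : Pol n) e → coeff (negP p) e ≈ - coeff p e
  coeff-negP []            e = sym ε⁻¹≈ε
  coeff-negP ((a , f) ∷ p) e with ≡-dec ℕ._≟_ f e
  ... | yes _ = trans (+-congˡ (coeff-negP p e)) (⁻¹-∙-comm _ _)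
  ... | no  _ = coeff-negP p e

  coeff--P : ∀ {n} (p q : Pol n) e → coeff (p -P q) e ≈ coeff p e - coeff q e
  coeff--P p q e = trans (coeff-++ p (negP q) e) (+-congˡ (coeff-negP q e))

  coeff-swapP : ∀ {n} k (p : Pol n) e → coeff (swapP k p) e ≈ coeff p (swapMon k e)
  coeff-swapP k []            e = ≈-refl
  coeff-swapP k ((a , f) ∷ p) e
    with ≡-dec ℕ._≟_ (swapMon k f) e | ≡-dec ℕ._≟_ f (swapMon k e)
  ... | yes _  | yes _  = +-congˡ (coeff-swapP k p e)
  ... | no  _  | no  _  = coeff-swapP k p e
  ... | yes eq | no  ne =
    ⊥-elim (ne (≡.trans (≡.sym (swapMon-involutive k f)) (cong (swapMon k) eq)))
  ... | no  ne | yes eq =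
    ⊥-elim (ne (≡.trans (cong (swapMon k) eq) (swapMon-involutive k e)))

  coeff-term*P-⊞ : ∀ {n} a (m : Mon n) q e → coeff (term*P a m q) (m ⊞ e) ≈ a * coeff q e
  coeff-term*P-⊞ a m []            e = sym (zeroʳ a)
  coeff-term*P-⊞ a m ((b , f) ∷ q) e
    with ≡-dec ℕ._≟_ (m ⊞ f) (m ⊞ e) | ≡-dec ℕ._≟_ f e
  ... | yes _  | yes _  = trans (+-congˡ (coeff-term*P-⊞ a m q e)) (sym (distribˡ a b _))
  ... | no  _  | no  _  = coeff-term*P-⊞ a m q e
  ... | yes eq | no  ne = ⊥-elim (ne (⊞-cancelˡ m eq))
  ... | no  ne | yes eq = ⊥-elim (ne (cong (m ⊞_) eq))

  coeff-term*P-∤ : ∀ {n} a (m : Mon n) q e → ¬ m ∣ᵐ e → coeff (term*P a m q) e ≈ 0#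
  coeff-term*P-∤ a m []            e m∤e = ≈-refl
  coeff-term*P-∤ a m ((b , f) ∷ q) e m∤e with ≡-dec ℕ._≟_ (m ⊞ f) e
  ... | yes m⊞f≡e = ⊥-elim (m∤e (f , m⊞f≡e))
  ... | no  _     = coeff-term*P-∤ a m q e m∤e

  coeff-term*P-neg : ∀ {n} (m : Mon n) q e →
    coeff (term*P (- 1#) m q) e ≈ - coeff (term*P 1# m q) e
  coeff-term*P-neg m []            e = sym ε⁻¹≈ε
  coeff-term*P-neg m ((b , f) ∷ q) e with ≡-dec ℕ._≟_ (m ⊞ f) e
  ... | yes _ = trans (+-cong -1*b≈-[1*b] (coeff-term*P-neg m q e)) (⁻¹-∙-comm _ _)
    where -1*b≈-[1*b] = trans (-1*x≈-x b) (-‿cong (sym (*-identityˡ b)))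
  ... | no  _ = coeff-term*P-neg m q e

  coeff-binomial-*P : ∀ {n} (m m′ : Mon n) h e →
    coeff (binomial m m′ *P h) e ≈ coeff (term*P 1# m h) e - coeff (term*P 1# m′ h) e
  coeff-binomial-*P m m′ h e = begin
    coeff (binomial m m′ *P h) e
      ≈⟨ coeff-++ (term*P 1# m h) _ e ⟩
    coeff (term*P 1# m h) e + coeff (term*P (- 1#) m′ h ++ []) e
      ≈⟨ +-congˡ (trans (coeff-++ (term*P (- 1#) m′ h) [] e) (+-identityʳ _)) ⟩
    coeff (term*P 1# m h) e + coeff (term*P (- 1#) m′ h) e
      ≈⟨ +-congˡ (coeff-term*P-neg m′ h e) ⟩
    coeff (term*P 1# m h) e - coeff (term*P 1# m′ h) e
      ∎
    where open SetoidReasoning setoid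

  term*P-cong : ∀ {n} a (m : Mon n) {q q′} → q ≋ q′ → term*P a m q ≋ term*P a m q′
  term*P-cong a m {q} {q′} q≋q′ e with m ∣ᵐ? e
  ... | yes (f , refl) =
    trans (coeff-term*P-⊞ a m q f) (trans (*-congˡ (q≋q′ f)) (sym (coeff-term*P-⊞ a m q′ f)))
  ... | no m∤e = trans (coeff-term*P-∤ a m q e m∤e) (sym (coeff-term*P-∤ a m q′ e m∤e))

  +P-cong : ∀ {n} {p p′ q q′ : Pol n} → p ≋ p′ → q ≋ q′ → (p +P q) ≋ (p′ +P q′)
  +P-cong {p = p} {p′} {q} {q′} p≋p′ q≋q′ e =
    trans (coeff-++ p q e) (trans (+-cong (p≋p′ e) (q≋q′ e)) (sym (coeff-++ p′ q′ e)))

  *P-congˡ : ∀ {n} (p : Pol n) {q q′} → q ≋ q′ → (p *P q) ≋ (p *P q′)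
  *P-congˡ []            q≋q′ e = ≈-refl
  *P-congˡ ((a , m) ∷ p) {q} {q′} q≋q′ =
    +P-cong {p = term*P a m q} {term*P a m q′} {p *P q} {p *P q′}
            (term*P-cong a m {q} {q′} q≋q′) (*P-congˡ p q≋q′)

  negP-cong : ∀ {n} {p q : Pol n} → p ≋ q → negP p ≋ negP q
  negP-cong {p = p} {q} p≋q e =
    trans (coeff-negP p e) (trans (-‿cong (p≋q e)) (sym (coeff-negP q e)))

  -P-cong : ∀ {n} {p p′ q q′ : Pol n} → p ≋ p′ → q ≋ q′ → (p -P q) ≋ (p′ -P q′)
  -P-cong {p = p} {p′} {q} {q′} p≋p′ q≋q′ =
    +P-cong {p = p} {p′} {negP q} {negP q′} p≋p′ (negP-cong {p = q} {q′} q≋q′)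

  swapP-cong : ∀ {n} k {p q : Pol n} → p ≋ q → swapP k p ≋ swapP k q
  swapP-cong k {p} {q} p≋q e =
    trans (coeff-swapP k p e) (trans (p≋q _) (sym (coeff-swapP k q e)))

  swapP-term*P : ∀ {n} k a (m : Mon n) q →
    swapP k (term*P a m q) ≡ term*P a (swapMon k m) (swapP k q)
  swapP-term*P k a m []            = refl
  swapP-term*P k a m ((b , f) ∷ q) =
    cong₂ _∷_ (cong (a * b ,_) (swapMon-⊞ k m f)) (swapP-term*P k a m q)

  swapP-*P : ∀ {n} k (p q : Pol n) → swapP k (p *P q) ≡ swapP k p *P swapP k q
  swapP-*P k []            q = refl
  swapP-*P k ((a , m) ∷ p) q =
    ≡.trans (map-++ _ (term*P a m q) (p *P q))
            (cong₂ _++_ (swapP-term*P k a m q) (swapP-*P k p q))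

  swapP--P : ∀ {n} k (p q : Pol n) → swapP k (p -P q) ≡ swapP k p -P swapP k q
  swapP--P k p q = ≡.trans (map-++ _ p (negP q)) (cong (swapP k p ++_) (swapP-negP q))
    where
    swapP-negP : ∀ q → swapP k (negP q) ≡ negP (swapP k q)
    swapP-negP []      = refl
    swapP-negP (_ ∷ q) = cong (_ ∷_) (swapP-negP q)

  swapP-comm : ∀ {n} k i (p : Pol n) → suc k < i → swapP i (swapP k p) ≡ swapP k (swapP i p)
  swapP-comm k i []            _   = refl
  swapP-comm k i ((a , f) ∷ p) k<i =
    cong₂ _∷_ (cong (a ,_) (swapMon-comm k i f k<i)) (swapP-comm k i p k<i)

  swapP-oneP : ∀ {n} i → swapP i (oneP {n}) ≡ oneP
  swapP-oneP {n} i = cong (λ m → (1# , m) ∷ []) (swapMon-replicate n i)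

  swapP-X-< : ∀ {n} m i → m < i → swapP i (X {n} m) ≡ X m
  swapP-X-< {n} m i m<i = cong (λ u → (1# , u) ∷ []) (swapMon-unitMon-< n m i m<i)

  swapP-X-suc : ∀ {n} i → 1 ≤ i → suc i ≤ n → swapP i (X {n} (suc i)) ≡ X i
  swapP-X-suc {n} i 1≤i i<n = cong (λ u → (1# , u) ∷ []) (swapMon-unitMon-suc n i 1≤i i<n)

  swapP-X-diff : ∀ {n} k i → suc k < i → swapP i (X {n} k -P X (suc k)) ≡ X k -P X (suc k)
  swapP-X-diff k i k+1<i = ≡.trans (swapP--P i (X k) (X (suc k)))
    (cong₂ _-P_ (swapP-X-< k i (ℕ.<-trans (ℕ.n<1+n k) k+1<i)) (swapP-X-< (suc k) i k+1<i))

  private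
    a-x≈b-y⇒x≈y⇒a≈b : ∀ {a b x y} → a - x ≈ b - y → x ≈ y → a ≈ b
    a-x≈b-y⇒x≈y⇒a≈b {a} {b} {x} {y} a-x≈b-y x≈y = begin
      a          ≈⟨ //-rightDividesˡ x a ⟨
      a - x + x  ≈⟨ +-cong a-x≈b-y x≈y ⟩
      b - y + y  ≈⟨ //-rightDividesˡ y b ⟩
      b          ∎
      where open SetoidReasoning setoid

    [a-c]-[a-b]≈b-c : ∀ a b c → (a - c) - (a - b) ≈ b - c
    [a-c]-[a-b]≈b-c a b c = begin
      (a - c) - (a - b)  ≈⟨ +-congˡ (⁻¹-anti-homo‿- a b) ⟩
      (a - c) + (b - a)  ≈⟨ +-comm _ _ ⟩
      (b - a) + (a - c)  ≈⟨ +-assoc b (- a) (a - c) ⟩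
      b + (- a + (a - c)) ≈⟨ +-congˡ (\\-leftDividesʳ a (- c)) ⟩
      b - c              ∎
      where open SetoidReasoning setoid

    a-0≈a : ∀ a → a - 0# ≈ a
    a-0≈a a = trans (+-congˡ ε⁻¹≈ε) (+-identityʳ a)

  -- Symmetry in xₖ, x_{k+1}

  IsSymmetric : ∀ {n} → ℕ → Pol n → Set ℓ
  IsSymmetric k f = swapP k f ≋ f

  IsDD-zero⇒IsSymmetric : ∀ {n} k (f : Pol n) → IsDD k f zeroP → IsSymmetric k f
  IsDD-zero⇒IsSymmetric k f ∂f≋0 e =
    sym (x∙y⁻¹≈ε⇒x≈y _ _ (sym (trans (∂f≋0 e) (coeff--P f (swapP k f) e))))

  IsSymmetric⇒IsDD-zero : ∀ {n} k (f : Pol n) → IsSymmetric k f → IsDD k f zeroP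
  IsSymmetric⇒IsDD-zero k f sym-f e =
    sym (trans (coeff--P f (swapP k f) e) (x≈y⇒x∙y⁻¹≈ε (sym (sym-f e))))

  *P-IsSymmetric : ∀ {n} i {p q : Pol n} → swapP i p ≡ p → IsSymmetric i q → IsSymmetric i (p *P q)
  *P-IsSymmetric i {p} {q} sᵢp≡p sym-q = begin
    swapP i (p *P q)        ≡⟨ swapP-*P i p q ⟩
    swapP i p *P swapP i q  ≡⟨ cong (_*P swapP i q) sᵢp≡p ⟩
    p *P swapP i q          ≈⟨ *P-congˡ p sym-q ⟩
    p *P q                  ∎
    where open SetoidReasoning (≋-setoid _)

  -- Divided differences

  -- Compare coefficients at xₖ·x^f, by induction on the exponent of x_{k+1} in f.
  X-diff-*P-cancelˡ : ∀ {n} k → 1 ≤ k → suc k ≤ n → {h h′ : Pol n} →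
    ((X k -P X (suc k)) *P h) ≋ ((X k -P X (suc k)) *P h′) → h ≋ h′
  X-diff-*P-cancelˡ {n} k 1≤k k<n {h} {h′} Dh≋Dh′ f = by-exponent _ f refl
    where
    open SetoidReasoning setoid
    xₖ xₖ₊₁ : Mon n
    xₖ   = unitMon n k
    xₖ₊₁ = unitMon n (suc k)

    D : Pol n
    D = X k -P X (suc k)

    coeff-D*P-⊞ : ∀ p f →
      coeff (D *P p) (xₖ ⊞ f) ≈ coeff p f - coeff (term*P 1# xₖ₊₁ p) (xₖ ⊞ f)
    coeff-D*P-⊞ p f = trans (coeff-binomial-*P xₖ xₖ₊₁ p (xₖ ⊞ f))
      (+-congʳ (trans (coeff-term*P-⊞ 1# xₖ p f) (*-identityˡ _)))

    coeff-D*P-exponent-zero : ∀ p f → exponent (suc k) f ≡ 0 →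
      coeff (D *P p) (xₖ ⊞ f) ≈ coeff p f
    coeff-D*P-exponent-zero p f f₍ₖ₊₁₎≡0 = begin
      coeff (D *P p) (xₖ ⊞ f)                        ≈⟨ coeff-D*P-⊞ p f ⟩
      coeff p f - coeff (term*P 1# xₖ₊₁ p) (xₖ ⊞ f)  ≈⟨ +-congˡ (-‿cong xₖ₊₁-term-vanishes) ⟩
      coeff p f - 0#                                 ≈⟨ a-0≈a _ ⟩
      coeff p f                                      ∎
      where
      xₖ₊₁-term-vanishes = coeff-term*P-∤ 1# xₖ₊₁ p _ (unitMon-suc-∤ n k f k<n f₍ₖ₊₁₎≡0)

    coeff-D*P-xₖ₊₁-⊞ : ∀ p f →
      coeff (D *P p) (xₖ ⊞ (xₖ₊₁ ⊞ f)) ≈ coeff p (xₖ₊₁ ⊞ f) - coeff p (xₖ ⊞ f)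
    coeff-D*P-xₖ₊₁-⊞ p f = trans (coeff-D*P-⊞ p (xₖ₊₁ ⊞ f)) (+-congˡ (-‿cong (begin
      coeff (term*P 1# xₖ₊₁ p) (xₖ ⊞ (xₖ₊₁ ⊞ f))
        ≡⟨ cong (coeff (term*P 1# xₖ₊₁ p)) (⊞-exchange xₖ xₖ₊₁ f) ⟩
      coeff (term*P 1# xₖ₊₁ p) (xₖ₊₁ ⊞ (xₖ ⊞ f))  ≈⟨ coeff-term*P-⊞ 1# xₖ₊₁ p (xₖ ⊞ f) ⟩
      1# * coeff p (xₖ ⊞ f)                      ≈⟨ *-identityˡ _ ⟩
      coeff p (xₖ ⊞ f)                           ∎)))

    by-exponent : ∀ t f → exponent (suc k) f ≡ t → coeff h f ≈ coeff h′ f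
    by-exponent zero f f₍ₖ₊₁₎≡0 = begin
      coeff h f                 ≈⟨ coeff-D*P-exponent-zero h f f₍ₖ₊₁₎≡0 ⟨
      coeff (D *P h) (xₖ ⊞ f)   ≈⟨ Dh≋Dh′ _ ⟩
      coeff (D *P h′) (xₖ ⊞ f)  ≈⟨ coeff-D*P-exponent-zero h′ f f₍ₖ₊₁₎≡0 ⟩
      coeff h′ f                ∎
    by-exponent (suc t) f f₍ₖ₊₁₎≡1+t
      with f″ , refl , f″₍ₖ₊₁₎≡t ← exponent≡suc⇒unitMon-∣ᵐ (suc k) f t f₍ₖ₊₁₎≡1+t =
      a-x≈b-y⇒x≈y⇒a≈b
        (trans (sym (coeff-D*P-xₖ₊₁-⊞ h f″)) (trans (Dh≋Dh′ _) (coeff-D*P-xₖ₊₁-⊞ h′ f″)))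
        (by-exponent t (xₖ ⊞ f″) (≡.trans (exponent-suc-unitMon-⊞ n k f″) f″₍ₖ₊₁₎≡t))

  IsDD-unique : ∀ {n} k → 1 ≤ k → suc k ≤ n → {f f′ h h′ : Pol n} →
    f ≋ f′ → IsDD k f h → IsDD k f′ h′ → h ≋ h′
  IsDD-unique k 1≤k k<n {f} {f′} {h} {h′} f≋f′ ∂f ∂f′ =
    X-diff-*P-cancelˡ k 1≤k k<n {h} {h′} (begin
      (X k -P X (suc k)) *P h   ≈⟨ ∂f ⟩
      f -P swapP k f            ≈⟨ -P-cong {p = f} {f′} {swapP k f} {swapP k f′} f≋f′ sₖf≋sₖf′ ⟩
      f′ -P swapP k f′          ≈⟨ ∂f′ ⟨
      (X k -P X (suc k)) *P h′  ∎)
    where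
    open SetoidReasoning (≋-setoid _)
    sₖf≋sₖf′ = swapP-cong k {f} {f′} f≋f′

  IsDD-swapP : ∀ {n} k i {f h : Pol n} → suc k < i → IsDD k f h → IsDD k (swapP i f) (swapP i h)
  IsDD-swapP k i {f} {h} k+1<i ∂f = begin
    D *P swapP i h                    ≡⟨ cong (_*P swapP i h) (swapP-X-diff k i k+1<i) ⟨
    swapP i D *P swapP i h            ≡⟨ swapP-*P i D h ⟨
    swapP i (D *P h)                  ≈⟨ swapP-cong i {D *P h} {f -P swapP k f} ∂f ⟩
    swapP i (f -P swapP k f)          ≡⟨ swapP--P i f (swapP k f) ⟩
    swapP i f -P swapP i (swapP k f)  ≡⟨ cong (swapP i f -P_) (swapP-comm k i f k+1<i) ⟩
    swapP i f -P swapP k (swapP i f)  ∎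
    where
    open SetoidReasoning (≋-setoid _)
    D = X k -P X (suc k)

  IsDD-preserves-IsSymmetric : ∀ {n} k i → 1 ≤ k → suc k ≤ n → suc k < i → {f h : Pol n} →
    IsSymmetric i f → IsDD k f h → IsSymmetric i h
  IsDD-preserves-IsSymmetric k i 1≤k k<n k+1<i {f} {h} sym-f ∂f =
    IsDD-unique k 1≤k k<n {swapP i f} {f} {swapP i h} {h}
      sym-f (IsDD-swapP k i {f} {h} k+1<i ∂f) ∂f

  IsPibar-preserves-IsSymmetric : ∀ {n} k i → 1 ≤ k → suc k ≤ n → suc k < i → {g g′ : Pol n} →
    IsSymmetric i g → IsPibar k g g′ → IsSymmetric i g′
  IsPibar-preserves-IsSymmetric k i 1≤k k<n k+1<i {g} {g′} sym-g π̄g =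
    IsDD-preserves-IsSymmetric k i 1≤k k<n k+1<i {M *P g} {g′}
      (*P-IsSymmetric i {M} {g} sᵢ-fixes-multiplier sym-g) π̄g
    where
    M = X k *P (oneP -P X (suc k))
    sᵢ-fixes-multiplier : swapP i M ≡ M
    sᵢ-fixes-multiplier = ≡.trans (swapP-*P i (X k) _) (cong₂ _*P_
      (swapP-X-< k i (ℕ.<-trans (ℕ.n<1+n k) k+1<i))
      (≡.trans (swapP--P i oneP (X (suc k)))
               (cong₂ _-P_ (swapP-oneP i) (swapP-X-< (suc k) i k+1<i))))

  -- Leibniz rule: ∂̄ₖ h = ∂ₖ(1 − x_{k+1}) · h = h.
  IsSymmetric⇒IsDDbar-self : ∀ {n} k → 1 ≤ k → suc k ≤ n → {h : Pol n} →
    IsSymmetric k h → IsDDbar k h h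
  IsSymmetric⇒IsDDbar-self {n} k 1≤k k<n {h} sym-h e = begin
    coeff (binomial xₖ xₖ₊₁ *P h) e      ≈⟨ coeff-binomial-*P xₖ xₖ₊₁ h e ⟩
    β - δ                                ≈⟨ [a-c]-[a-b]≈b-c α β δ ⟨
    (α - δ) - (α - β)
      ≈⟨ +-cong (coeff-binomial-*P 1ᵐ xₖ₊₁ h e) (-‿cong coeff-sₖ[Ph]) ⟨
    coeff P*h e - coeff (swapP k P*h) e  ≈⟨ coeff--P P*h (swapP k P*h) e ⟨
    coeff (P*h -P swapP k P*h) e         ∎
    where
    open SetoidReasoning setoid
    1ᵐ xₖ xₖ₊₁ : Mon n
    1ᵐ   = replicate n 0
    xₖ   = unitMon n k
    xₖ₊₁ = unitMon n (suc k)
    α = coeff (term*P 1# 1ᵐ h) e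
    β = coeff (term*P 1# xₖ h) e
    δ = coeff (term*P 1# xₖ₊₁ h) e
    P*h = (oneP -P X (suc k)) *P h

    sₖ[1-xₖ₊₁]≡1-xₖ : swapP k (oneP -P X (suc k)) ≡ oneP -P X k
    sₖ[1-xₖ₊₁]≡1-xₖ = ≡.trans (swapP--P k oneP (X (suc k)))
      (cong₂ _-P_ (swapP-oneP k) (swapP-X-suc k 1≤k k<n))

    coeff-sₖ[Ph] : coeff (swapP k P*h) e ≈ α - β
    coeff-sₖ[Ph] = begin
      coeff (swapP k P*h) e
        ≡⟨ cong (λ p → coeff p e) (swapP-*P k (oneP -P X (suc k)) h) ⟩
      coeff (swapP k (oneP -P X (suc k)) *P swapP k h) e
        ≡⟨ cong (λ p → coeff (p *P swapP k h) e) sₖ[1-xₖ₊₁]≡1-xₖ ⟩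
      coeff (binomial 1ᵐ xₖ *P swapP k h) e
        ≈⟨ *P-congˡ (binomial 1ᵐ xₖ) {swapP k h} {h} sym-h e ⟩
      coeff (binomial 1ᵐ xₖ *P h) e                  ≈⟨ coeff-binomial-*P 1ᵐ xₖ h e ⟩
      α - β                                          ∎

open import Data.Nat using (_+_)

lemma5p10 : ∀ {c ℓ} (R : CommutativeRing c ℓ) (n j γ : ℕ) →
    1 ≤ j → 2 ≤ γ → j + γ ≤ n →
    (g : Poly.Pol R n) →
    (∀ i → suc j ≤ i → i ≤ j + γ ∸ 1 → Poly.IsDDbar R i g g) →
    (∀ i → suc j ≤ i → i ≤ j + γ ∸ 1 → Poly.IsDD R i g (Poly.zeroP R)) →
    (g' : Poly.Pol R n) → Poly.IsPibar R j g g' →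
    (∀ i → suc (suc j) ≤ i → i ≤ suc j + (γ ∸ 1) ∸ 1 → Poly.IsDDbar R i g' g')
    × (∀ i → suc (suc j) ≤ i → i ≤ suc j + (γ ∸ 1) ∸ 1 → Poly.IsDD R i g' (Poly.zeroP R))
lemma5p10 R n j (suc γ′) 1≤j _ j+γ≤n g _ ∂g≋0 g′ π̄g =
  (λ i j+2≤i i≤j+γ′ → IsSymmetric⇒IsDDbar-self i (ℕ.≤-trans (s≤s z≤n) j+2≤i) (i<n i≤j+γ′) {g′}
                         (sym-g′ i j+2≤i i≤j+γ′)) ,
  (λ i j+2≤i i≤j+γ′ → IsSymmetric⇒IsDD-zero i g′ (sym-g′ i j+2≤i i≤j+γ′))
  where
  open Properties R
  j+γ′<n : suc (j + γ′) ≤ n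
  j+γ′<n = ≡.subst (_≤ n) (ℕ.+-suc j γ′) j+γ≤n

  i<n : ∀ {i} → i ≤ j + γ′ → suc i ≤ n
  i<n i≤j+γ′ = ℕ.≤-trans (s≤s i≤j+γ′) j+γ′<n

  sym-g′ : ∀ i → suc (suc j) ≤ i → i ≤ j + γ′ → IsSymmetric i g′
  sym-g′ i j+2≤i i≤j+γ′ =
    IsPibar-preserves-IsSymmetric j i 1≤j (i<n (ℕ.m≤m+n j γ′)) j+2≤i {g} {g′} sym-g π̄g
    where
    sym-g : IsSymmetric i g
    sym-g = IsDD-zero⇒IsSymmetric i g (∂g≋0 i (ℕ.<⇒≤ j+2≤i)
      (≡.subst (i ≤_) (cong (_∸ 1) (≡.sym (ℕ.+-suc j γ′))) i≤j+γ′))
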